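{- Let $\mathcal{A}$ be a deterministic leader election algorithm in the $\mathsf{Strong}\text{ - }\mathsf{CD}$ model on ID space $[N]$ with energy complexity $k$. Then for every $j \in [N]$, the device with $\mathsf{ID} = j$ has at most $2^k$ potential active time slots.
   Context: Single-hop radio network in the $\mathsf{Strong}\text{ - }\mathsf{CD}$ model: devices with distinct identifiers in $[N]=\{1,\dots,N\}$ act in synchronous time slots, in each slot being idle, listening or transmitting, as a deterministic function of their ID, known parameters and feedback so far; transmitters and listeners receive silence (no transmitter), collision (at least two transmitters) or the message (exactly one transmitter). Energy complexity $k$ means every device listens or transmits in at most $k$ time slots in every execution. Let $t$ be the time complexity of $\mathcal{A}$. For $j \in [N]$ and $i \in [t]$, set $g_i(j) = 0$ if the device with $\mathsf{ID} = j$ is idle in time slot $i$ regardless of which feedback it received in slots $1,\dots,i-1$, where only feedback sequences consisting of collision or silence (no successful message) are considered; otherwise $g_i(j) = 1$. If $g_i(j)=1$, slot $i$ is a potential active time slot for the device with $\mathsf{ID}=j$. -}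

module Defs where

open import Data.Nat using (ℕ; zero; suc; _+_; _≤_)
open import Data.Bool using (Bool; true; false)
open import Data.Maybe using (Maybe; just; nothing)
open import Data.List using (List; []; _∷_)
open import Data.Fin using (Fin; toℕ)
open import Data.Fin.Subset using (Subset; _∈_)
open import Data.Vec using (lookup)
open import Data.Product using (Σ; ∃; _×_; _,_)
open import Relation.Binary.PropositionalEquality using (_≡_)

-- Single-hop radio network, Strong-CD model.
-- Device IDs: Fin N (ID j ∈ [N] corresponds to a value of Fin N).
-- Time slots are numbered 0,1,2,… (slot i here = slot i+1 of the paper).

data Feedback (M : Set) : Set where
  silence   : Feedback M
  collision : Feedback M
  message   : M → Feedback M

data Action (M : Set) : Set where
  idle     : Action M
  listen   : Action M
  transmit : M → Action M

isActive : {M : Set} → Action M → Bool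
isActive idle         = false
isActive listen       = true
isActive (transmit _) = true

Obs : Set → Set
Obs M = Maybe (Feedback M)

observe : {M : Set} → Action M → Feedback M → Obs M
observe idle         _  = nothing
observe listen       fb = just fb
observe (transmit _) fb = just fb

-- A local history: the observations of all past slots, most recent first
-- (its length is the index of the current slot).
History : Set → Set
History M = List (Obs M)

-- A deterministic algorithm on ID space [N] with time complexity t:
-- the action of a device is a function of its ID (and the known
-- parameters, which are fixed) and the feedback received so far;
-- after t slots each device outputs whether it is the leader.
record Algorithm (M : Set) (N : ℕ) : Set where
  field
    time   : ℕ
    act    : Fin N → History M → Action M
    leader : Fin N → History M → Bool
open Algorithm public

msgOf : {M : Set} → Action M → Maybe M
msgOf (transmit m) = just m
msgOf _            = nothing

transmissions : {M : Set} {N : ℕ} → (Fin N → History M → Action M) →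
                Subset N → (Fin N → History M) → List (Fin N) → List M
transmissions a S h [] = []
transmissions a S h (j ∷ js) with lookup S j | msgOf (a j (h j))
... | true  | just m  = m ∷ transmissions a S h js
... | _     | _       = transmissions a S h js

channel : {M : Set} → List M → Feedback M
channel []          = silence
channel (m ∷ [])    = message m
channel (_ ∷ _ ∷ _) = collision

open import Data.List using (allFin)

step : {M : Set} {N : ℕ} → Algorithm M N → Subset N →
       (Fin N → History M) → (Fin N → History M)
step A S h j with lookup S j
... | false = h j
... | true  = observe (act A j (h j))
                      (channel (transmissions (act A) S h (allFin _))) ∷ h j

globalHist : {M : Set} {N : ℕ} → Algorithm M N → Subset N → ℕ → Fin N → History M
globalHist A S zero    j = []
globalHist A S (suc i) j = step A S (globalHist A S i) j

IsLeaderElection : {M : Set} {N : ℕ} → Algorithm M N → Set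
IsLeaderElection {N = N} A =
  (S : Subset N) → (∃ λ j → j ∈ S) →
    (∃ λ j → j ∈ S × leader A j (globalHist A S (time A) j) ≡ true)
  × (∀ j j′ → j ∈ S → j′ ∈ S →
       leader A j  (globalHist A S (time A) j)  ≡ true →
       leader A j′ (globalHist A S (time A) j′) ≡ true → j ≡ j′)

localHist : {M : Set} → (History M → Action M) → (ℕ → Feedback M) → ℕ → History M
localHist a f zero    = []
localHist a f (suc i) = observe (a (localHist a f i)) (f i) ∷ localHist a f i

activeCount : {M : Set} → (History M → Action M) → (ℕ → Feedback M) → ℕ → ℕ
activeCount a f zero = 0
activeCount a f (suc i) with isActive (a (localHist a f i))
... | true  = suc (activeCount a f i)
... | false = activeCount a f i

EnergyComplexity : {M : Set} {N : ℕ} → Algorithm M N → ℕ → Set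
EnergyComplexity A k =
  ∀ j (f : ℕ → Feedback _) → activeCount (act A j) f (time A) ≤ k

scFeedback : {M : Set} → Bool → Feedback M
scFeedback true  = collision
scFeedback false = silence

Potential : {M : Set} {N : ℕ} → Algorithm M N → Fin N → ℕ → Set
Potential A j i =
  ∃ λ (f : ℕ → Bool) →
    isActive (act A j (localHist (act A j) (λ n → scFeedback (f n)) i)) ≡ true

-- A device that only ever hears silence or collision behaves like a binary
-- decision tree: each slot in which it is active branches on one bit of
-- feedback, and each root-to-leaf path is active at most k times.  Hence the
-- tree has at most 2^k − 1 active nodes, and every potential active slot is
-- the slot of one of them.  Formally, induct on the number of slots and peel
-- off the first one: an idle first slot is not potential and does not branch;
-- an active one spends one unit of energy and splits the remaining potential
-- slots into those witnessed after silence and those witnessed after collision.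
module Submission where

open import Defs
open import Data.Nat using (ℕ; _≤_; _^_)
open import Data.Fin using (Fin; toℕ)
open import Data.Fin.Subset using (Subset; _∈_; ∣_∣)

open import Data.Bool using (Bool; true; false; if_then_else_; _≟_)
open import Data.Fin using (zero; suc)
open import Data.Fin.Subset using (inside; outside)
open import Data.List using ([]; _∷_; _++_; [_])
open import Data.Nat using (zero; suc; _+_; _<_; s≤s⁻¹)
open import Data.Nat.Properties
  using (+-commutativeSemigroup; +-suc; +-identityʳ; +-mono-≤; ≤-refl; <⇒≤; n≤1+n; m^n>0; module ≤-Reasoning)
open import Algebra.Properties.CommutativeSemigroup +-commutativeSemigroup
  using (x∙yz≈y∙xz)
open import Data.Product using (Σ; ∃; _,_; proj₁)
open import Data.Vec using ([]; _∷_; here; there)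
open import Function using (_∘_)
open import Relation.Nullary using (¬_; yes; no; does; contradiction)
open import Relation.Binary.PropositionalEquality
  using (_≡_; refl; sym; trans; cong; cong₂; subst; module ≡-Reasoning)

prepend : {A : Set} → A → (ℕ → A) → ℕ → A
prepend x f zero    = x
prepend x f (suc n) = f n

1+m+n<2^1+k : ∀ {m n k} → m < 2 ^ k → n < 2 ^ k → suc (m + n) < 2 ^ suc k
1+m+n<2^1+k {m} {n} {k} m< n< = begin
  suc (suc (m + n)) ≡⟨ cong suc (sym (+-suc m n)) ⟩
  suc m + suc n     ≤⟨ +-mono-≤ m< n< ⟩
  2 ^ k + 2 ^ k     ≡⟨ cong (2 ^ k +_) (sym (+-identityʳ (2 ^ k))) ⟩
  2 ^ suc k         ∎
  where open ≤-Reasoning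

∣x∷p∣≤1+∣p∣ : ∀ {n} x (p : Subset n) → ∣ x ∷ p ∣ ≤ suc ∣ p ∣
∣x∷p∣≤1+∣p∣ inside  p = ≤-refl
∣x∷p∣≤1+∣p∣ outside p = n≤1+n ∣ p ∣

select : ∀ {n} (p : Subset n) → (∀ i → i ∈ p → Bool) → Bool → Subset n
select []          c β = []
select (outside ∷ p) c β = outside ∷ select p (λ i q → c (suc i) (there q)) β
select (inside  ∷ p) c β = does (c zero here ≟ β) ∷ select p (λ i q → c (suc i) (there q)) β

∈-select : ∀ {n} {p : Subset n} {c : ∀ i → i ∈ p → Bool} {β i} →
           i ∈ select p c β → Σ (i ∈ p) λ q → c i q ≡ β
∈-select {p = inside ∷ p} {c} {β} {zero} x∈ with c zero here ≟ β | x∈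
... | yes e | _ = here , e
... | no _  | ()
∈-select {p = inside ∷ p} {c} {i = suc i} (there x∈) with ∈-select x∈
... | q , e = there q , e
∈-select {p = outside ∷ p} {c} {i = suc i} (there x∈) with ∈-select x∈
... | q , e = there q , e

∣select-true∣+∣select-false∣≡∣p∣ : ∀ {n} (p : Subset n) (c : ∀ i → i ∈ p → Bool) →
  ∣ select p c true ∣ + ∣ select p c false ∣ ≡ ∣ p ∣
∣select-true∣+∣select-false∣≡∣p∣ []          c = refl
∣select-true∣+∣select-false∣≡∣p∣ (outside ∷ p) c =
  ∣select-true∣+∣select-false∣≡∣p∣ p (λ i q → c (suc i) (there q))
∣select-true∣+∣select-false∣≡∣p∣ (inside ∷ p) c with c zero here
... | true  = cong suc (∣select-true∣+∣select-false∣≡∣p∣ p (λ i q → c (suc i) (there q)))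
... | false = trans (+-suc _ _)
                    (cong suc (∣select-true∣+∣select-false∣≡∣p∣ p (λ i q → c (suc i) (there q))))

module _ {M : Set} where

  Protocol : Set
  Protocol = History M → Action M

  -- Histories are most recent first, so the first observation goes last.
  after : Protocol → Obs M → Protocol
  after a o h = a (h ++ [ o ])

  next : Protocol → Bool → Protocol
  next a b = after a (observe (a []) (scFeedback b))

  localHist-suc : ∀ a (f : ℕ → Feedback M) i →
    localHist a f (suc i) ≡
    localHist (after a (observe (a []) (f 0))) (f ∘ suc) i ++ [ observe (a []) (f 0) ]
  localHist-suc a f zero    = refl
  localHist-suc a f (suc i) rewrite localHist-suc a f i = refl

  activeCount-step : ∀ a (f : ℕ → Feedback M) i →
    activeCount a f (suc i) ≡ (if isActive (a (localHist a f i)) then 1 else 0) + activeCount a f i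
  activeCount-step a f i with isActive (a (localHist a f i))
  ... | true  = refl
  ... | false = refl

  activeCount-suc : ∀ a (f : ℕ → Feedback M) i →
    activeCount a f (suc i) ≡
    (if isActive (a []) then 1 else 0) + activeCount (after a (observe (a []) (f 0))) (f ∘ suc) i
  activeCount-suc a f zero = activeCount-step a f 0
  activeCount-suc a f (suc i) = begin
    activeCount a f (suc (suc i))
      ≡⟨ activeCount-step a f (suc i) ⟩
    bit (a (localHist a f (suc i))) + activeCount a f (suc i)
      ≡⟨ cong₂ _+_ (cong (bit ∘ a) (localHist-suc a f i)) (activeCount-suc a f i) ⟩
    bit (a′ (localHist a′ (f ∘ suc) i)) + (bit (a []) + activeCount a′ (f ∘ suc) i)
      ≡⟨ x∙yz≈y∙xz (bit (a′ (localHist a′ (f ∘ suc) i))) (bit (a [])) _ ⟩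
    bit (a []) + (bit (a′ (localHist a′ (f ∘ suc) i)) + activeCount a′ (f ∘ suc) i)
      ≡⟨ cong (bit (a []) +_) (sym (activeCount-step a′ (f ∘ suc) i)) ⟩
    bit (a []) + activeCount a′ (f ∘ suc) (suc i) ∎
    where
    open ≡-Reasoning
    bit : Action M → ℕ
    bit x = if isActive x then 1 else 0
    a′ : Protocol
    a′ = after a (observe (a []) (f 0))

  EnergyAtMost : Protocol → ℕ → ℕ → Set
  EnergyAtMost a T k = ∀ (f : ℕ → Bool) → activeCount a (scFeedback ∘ f) T ≤ k

  PotentialSlot : Protocol → ℕ → Set
  PotentialSlot a i = ∃ λ (f : ℕ → Bool) → isActive (a (localHist a (scFeedback ∘ f) i)) ≡ true

  AllPotential : ∀ {T} → Protocol → Subset T → Set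
  AllPotential a s = ∀ i → i ∈ s → PotentialSlot a (toℕ i)

  energy-next : ∀ a {T k β} → isActive (a []) ≡ β → EnergyAtMost a (suc T) k →
    ∀ b f → (if β then 1 else 0) + activeCount (next a b) (scFeedback ∘ f) T ≤ k
  energy-next a {T} {k} active E b f =
    subst (_≤ k) (trans (activeCount-suc a (scFeedback ∘ prepend b f) T)
                        (cong (λ β → (if β then 1 else 0) + _) active))
          (E (prepend b f))

  potential-next : ∀ a {i} (P : PotentialSlot a (suc i)) → PotentialSlot (next a (proj₁ P 0)) i
  potential-next a {i} (f , active) =
    f ∘ suc , subst (λ h → isActive (a h) ≡ true) (localHist-suc a (scFeedback ∘ f) i) active

  inactive-not-potential : ∀ a → isActive (a []) ≡ false → ¬ PotentialSlot a 0
  inactive-not-potential _ inactive (_ , active) = contradiction (trans (sym active) inactive) λ ()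

  -- An idle slot observes nothing, so its feedback does not influence the future.
  potential-after-idle : ∀ a {T b} {s : Subset T} → isActive (a []) ≡ false →
    AllPotential a (b ∷ s) → AllPotential (next a false) s
  potential-after-idle a inactive H i q =
    subst (λ a′ → PotentialSlot a′ (toℕ i))
          (cong (after a) (observe-inactive (a []) inactive))
          (potential-next a (H (suc i) (there q)))
    where
    observe-inactive : ∀ x {fb fb′} → isActive x ≡ false → observe x fb ≡ observe {M} x fb′
    observe-inactive idle _ = refl

  firstBit : ∀ a {T b} {s : Subset T} → AllPotential a (b ∷ s) → ∀ i → i ∈ s → Bool
  firstBit _ H i q = proj₁ (H (suc i) (there q)) 0

  potential-select : ∀ a {T b} {s : Subset T} (H : AllPotential a (b ∷ s)) β →
    AllPotential (next a β) (select s (firstBit a H) β)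
  potential-select a H β i x∈ with ∈-select x∈
  ... | q , e = subst (λ a′ → PotentialSlot a′ (toℕ i)) (cong (next a) e)
                      (potential-next a (H (suc i) (there q)))

  ∣potential∣<2^energy : ∀ T k a (s : Subset T) →
    EnergyAtMost a T k → AllPotential a s → ∣ s ∣ < 2 ^ k
  ∣potential∣<2^energy zero k a [] E H = m^n>0 2 k
  ∣potential∣<2^energy (suc T) k a (b ∷ s) E H with isActive (a []) in active
  ∣potential∣<2^energy (suc T) k a (inside ∷ s) E H | false =
    contradiction (H zero here) (inactive-not-potential a active)
  ∣potential∣<2^energy (suc T) k a (outside ∷ s) E H | false =
    ∣potential∣<2^energy T k (next a false) s (energy-next a active E false)
                          (potential-after-idle a active H)
  ∣potential∣<2^energy (suc T) zero a (b ∷ s) E H | true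
    with () ← energy-next a active E false (λ _ → false)
  ∣potential∣<2^energy (suc T) (suc k) a (b ∷ s) E H | true = begin-strict
    ∣ b ∷ s ∣                                       ≤⟨ ∣x∷p∣≤1+∣p∣ b s ⟩
    suc ∣ s ∣                                       ≡⟨ cong suc (sym (∣select-true∣+∣select-false∣≡∣p∣ s c)) ⟩
    suc (∣ select s c true ∣ + ∣ select s c false ∣) <⟨ 1+m+n<2^1+k {k = k} (branch true) (branch false) ⟩
    2 ^ suc k                                       ∎
    where
    open ≤-Reasoning
    c : ∀ i → i ∈ s → Bool
    c = firstBit a H
    branch : ∀ β → ∣ select s c β ∣ < 2 ^ k
    branch β = ∣potential∣<2^energy T k (next a β) (select s c β)
                 (λ f → s≤s⁻¹ (energy-next a active E β f)) (potential-select a H β)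

claim4p6 : {M : Set} (N k : ℕ) (A : Algorithm M N) →
    IsLeaderElection A → EnergyComplexity A k →
    (j : Fin N) (s : Subset (time A)) →
    (∀ i → i ∈ s → Potential A j (toℕ i)) →
    ∣ s ∣ ≤ 2 ^ k
claim4p6 N k A _ E j s H =
  <⇒≤ (∣potential∣<2^energy (time A) k (act A j) s (λ f → E j (scFeedback ∘ f)) H)
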